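{- Let $n$ be even and let $k$ be an integer with $1\leq k\leq n-2$. Then there exists a $k$-regular graph $G$ of order $n$ such that (i) $G$ is $1$-factorable, and (ii) there is a vertex $u$ of $G$ and $\lfloor k/2\rfloor$ pairwise vertex-disjoint pairs $\{x_i,y_i\}$ of vertices in the neighbourhood $N_G(u)$ with $x_iy_i\notin E(G)$ for each $i$ (i.e., $\lfloor k/2\rfloor$ matching edges can be added to $G[N_G(u)]$).
   Context: All graphs are simple and finite. A graph is $1$-factorable if its edge set can be partitioned into edge-disjoint perfect matchings ($1$-factors). $N_G(u)$ denotes the set of neighbours of $u$ in $G$, and $G[S]$ the subgraph induced by $S$. -}

module Defs where

open import Data.Nat using (ℕ; zero; suc; _+_)
open import Data.Fin using (Fin; zero; suc)
open import Data.Bool using (Bool; true; false)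
open import Data.Product using (Σ; _×_; ∃)
open import Relation.Binary.PropositionalEquality using (_≡_; _≢_)

record Graph (n : ℕ) : Set where
  field
    adj   : Fin n → Fin n → Bool
    sym   : ∀ x y → adj x y ≡ adj y x
    irrefl : ∀ x → adj x x ≡ false
open Graph public

countTrue : ∀ {m} → (Fin m → Bool) → ℕ
countTrue {zero}  f = 0
countTrue {suc m} f with f zero
... | true  = suc (countTrue (λ i → f (suc i)))
... | false = countTrue (λ i → f (suc i))

degree : ∀ {n} → Graph n → Fin n → ℕ
degree G u = countTrue (adj G u)

Regular : ∀ {n} → ℕ → Graph n → Set
Regular k G = ∀ u → degree G u ≡ k

record PerfectMatching {n : ℕ} (G : Graph n) : Set where
  field
    partner  : Fin n → Fin n
    invol    : ∀ x → partner (partner x) ≡ x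
    isEdge   : ∀ x → adj G x (partner x) ≡ true
open PerfectMatching public

OneFactorable : ∀ {n} → Graph n → Set
OneFactorable {n} G =
  Σ ℕ λ m → Σ (Fin m → PerfectMatching G) λ F →
    (∀ x y → adj G x y ≡ true → Σ (Fin m) λ i → partner (F i) x ≡ y)
    × (∀ i j x → partner (F i) x ≡ partner (F j) x → i ≡ j)

module Submission where

-- The graph is cut out of the classical 1-factorisation GK₂ₘ of the complete
-- graph on n = q + 1 vertices, q = 2a + 1 odd.  Take the vertices ∞ and Z_q and
-- colour an edge xy (x, y ∈ Z_q) by x + y, and an edge ∞x by 2x.  Because q is
-- odd, every vertex meets exactly one edge of each colour j ∈ Z_q, so each colour
-- class is a perfect matching, the "mate" map of colour j.  The union G of the
-- colour classes 1, ..., k (k ≤ n - 2 = q - 1) is therefore k-regular and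
-- 1-factorable.  Around the vertex u = 0 the neighbours are exactly 1, ..., k,
-- and the pairs {i + 1, k - i} (i < ⌊k/2⌋) are disjoint non-edges of G, since
-- their colour k + 1 ≡ 0 or k + 1 lies outside 1, ..., k.

open import Defs hiding (sym)
open import Data.Nat using (ℕ; zero; suc; _+_; _*_; _∸_; _≤_; _<_; _≟_; _≤?_; NonZero; z≤n; s≤s)
open import Data.Nat.Properties
  using (+-assoc; +-comm; +-identityʳ; *-comm; <-irrefl; <⇒≤; ≤-<-trans; <-≤-trans;
         m+[n∸m]≡n; m∸n+n≡m; m∸n≤m; ∸-cancelˡ-≡; m<n⇒0<n∸m; m≤n⇒m<n∨m≡n; +-mono-≤-<)
import Data.Nat.Properties as ℕ
open import Data.Nat.DivMod
  using (_%_; _/_; %-distribˡ-+; %-distribˡ-*; m%n%n≡m%n; [m+n]%n≡m%n; [m+kn]%n≡m%n;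
         m<n⇒m%n≡m; m%n<n; n%n≡0; m/n*n≤m; m/n≤m)
open import Data.Nat.Tactic.RingSolver using (solve-∀)
open import Data.Fin using (Fin; zero; suc; toℕ; fromℕ<)
open import Data.Fin.Properties using (toℕ-fromℕ<; toℕ-injective; toℕ<n; suc-injective; cantor-schröder-bernstein)
import Data.Fin.Properties as Fin
open import Data.Bool using (Bool; true; false)
open import Data.Product using (Σ; _×_; _,_; proj₁; proj₂)
open import Data.Sum using (inj₁; inj₂)
open import Data.Empty using (⊥-elim)
open import Function using (_∘_)
open import Function.Bundles using (mk⇔)
open import Relation.Nullary using (Dec; yes; no; ¬_)
open import Relation.Nullary.Decidable using (does; _×-dec_; ¬?; dec-true; dec-false; does-⇔)
open import Relation.Binary.PropositionalEquality
  using (_≡_; _≢_; refl; sym; trans; cong; cong₂; subst; module ≡-Reasoning)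

select : ∀ {m} (f : Fin m → Bool) → Fin (countTrue f) → Fin m
select {suc m} f c with f zero
select {suc m} f zero    | true  = zero
select {suc m} f (suc c) | true  = suc (select (f ∘ suc) c)
select {suc m} f c       | false = suc (select (f ∘ suc) c)

select-true : ∀ {m} (f : Fin m → Bool) c → f (select f c) ≡ true
select-true {suc m} f c with f zero in eq
select-true {suc m} f zero    | true  = eq
select-true {suc m} f (suc c) | true  = select-true (f ∘ suc) c
select-true {suc m} f c       | false = select-true (f ∘ suc) c

select-injective : ∀ {m} (f : Fin m → Bool) {c d} → select f c ≡ select f d → c ≡ d
select-injective {suc m} f {c} {d} e with f zero
select-injective {suc m} f {zero}  {zero}  e | true  = refl
select-injective {suc m} f {suc c} {suc d} e | true  = cong suc (select-injective (f ∘ suc) (suc-injective e))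
select-injective {suc m} f {c}     {d}     e | false = select-injective (f ∘ suc) (suc-injective e)

rank : ∀ {m} (f : Fin m → Bool) w → f w ≡ true → Fin (countTrue f)
rank {suc m} f zero    p with f zero
... | true = zero
rank {suc m} f (suc w) p with f zero
... | true  = suc (rank (f ∘ suc) w p)
... | false = rank (f ∘ suc) w p

select-rank : ∀ {m} (f : Fin m → Bool) w (p : f w ≡ true) → select f (rank f w p) ≡ w
select-rank {suc m} f zero    p with f zero
... | true = refl
select-rank {suc m} f (suc w) p with f zero
... | true  = cong suc (select-rank (f ∘ suc) w p)
... | false = cong suc (select-rank (f ∘ suc) w p)

countTrue-bijection : ∀ {m k} (f : Fin m → Bool) (g : Fin k → Fin m) →
  (∀ {i j} → g i ≡ g j → i ≡ j) → (∀ i → f (g i) ≡ true) →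
  (∀ w → f w ≡ true → Σ (Fin k) λ i → g i ≡ w) → countTrue f ≡ k
countTrue-bijection {k = k} f g g-injective g-true g-onto =
  sym (cantor-schröder-bernstein {f = into} {g = back} into-injective back-injective)
  where
  into : Fin k → Fin (countTrue f)
  into i = rank f (g i) (g-true i)
  into-injective : ∀ {i j} → into i ≡ into j → i ≡ j
  into-injective {i} {j} e = g-injective (begin
    g i                 ≡⟨ sym (select-rank f (g i) (g-true i)) ⟩
    select f (into i)   ≡⟨ cong (select f) e ⟩
    select f (into j)   ≡⟨ select-rank f (g j) (g-true j) ⟩
    g j                 ∎)
    where open ≡-Reasoning
  back : Fin (countTrue f) → Fin k
  back c = proj₁ (g-onto (select f c) (select-true f c))
  back-injective : ∀ {c d} → back c ≡ back d → c ≡ d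
  back-injective {c} {d} e = select-injective f (begin
    select f c   ≡⟨ sym (proj₂ (g-onto (select f c) (select-true f c))) ⟩
    g (back c)   ≡⟨ cong g e ⟩
    g (back d)   ≡⟨ proj₂ (g-onto (select f d) (select-true f d)) ⟩
    select f d   ∎)
    where open ≡-Reasoning

module Modular (d : ℕ) .{{_ : NonZero d}} where

  %-absorbˡ : ∀ m n → (m % d + n) % d ≡ (m + n) % d
  %-absorbˡ m n = begin
    (m % d + n) % d            ≡⟨ %-distribˡ-+ (m % d) n d ⟩
    (m % d % d + n % d) % d    ≡⟨ cong (λ t → (t + n % d) % d) (m%n%n≡m%n m d) ⟩
    (m % d + n % d) % d        ≡⟨ sym (%-distribˡ-+ m n d) ⟩
    (m + n) % d                ∎
    where open ≡-Reasoning

  %-absorbʳ : ∀ m n → (m + n % d) % d ≡ (m + n) % d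
  %-absorbʳ m n = begin
    (m + n % d) % d   ≡⟨ cong (_% d) (+-comm m (n % d)) ⟩
    (n % d + m) % d   ≡⟨ %-absorbˡ n m ⟩
    (n + m) % d       ≡⟨ cong (_% d) (+-comm n m) ⟩
    (m + n) % d       ∎
    where open ≡-Reasoning

  %-absorb-*ˡ : ∀ m n → (m % d * n) % d ≡ (m * n) % d
  %-absorb-*ˡ m n = begin
    (m % d * n) % d            ≡⟨ %-distribˡ-* (m % d) n d ⟩
    (m % d % d * (n % d)) % d  ≡⟨ cong (λ t → (t * (n % d)) % d) (m%n%n≡m%n m d) ⟩
    (m % d * (n % d)) % d      ≡⟨ sym (%-distribˡ-* m n d) ⟩
    (m * n) % d                ∎
    where open ≡-Reasoning

  -- d ∸ x represents -x: adding x and d ∸ x to y amounts to adding d.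
  +-negate : ∀ {x} y → x ≤ d → x + (y + (d ∸ x)) ≡ y + d
  +-negate {x} y x≤d = begin
    x + (y + (d ∸ x))   ≡⟨ cong (x +_) (+-comm y (d ∸ x)) ⟩
    x + ((d ∸ x) + y)   ≡⟨ sym (+-assoc x (d ∸ x) y) ⟩
    (x + (d ∸ x)) + y   ≡⟨ cong (_+ y) (m+[n∸m]≡n x≤d) ⟩
    d + y               ≡⟨ +-comm d y ⟩
    y + d               ∎
    where open ≡-Reasoning

  subtract-add : ∀ {x} y → x ≤ d → ((x + y) % d + (d ∸ x)) % d ≡ y % d
  subtract-add {x} y x≤d = begin
    ((x + y) % d + (d ∸ x)) % d   ≡⟨ %-absorbˡ (x + y) (d ∸ x) ⟩
    ((x + y) + (d ∸ x)) % d       ≡⟨ cong (_% d) (+-assoc x y (d ∸ x)) ⟩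
    (x + (y + (d ∸ x))) % d       ≡⟨ cong (_% d) (+-negate y x≤d) ⟩
    (y + d) % d                   ≡⟨ [m+n]%n≡m%n y d ⟩
    y % d                         ∎
    where open ≡-Reasoning

  add-subtract : ∀ {x} y → x ≤ d → (x + (y + (d ∸ x)) % d) % d ≡ y % d
  add-subtract {x} y x≤d = begin
    (x + (y + (d ∸ x)) % d) % d   ≡⟨ %-absorbʳ x (y + (d ∸ x)) ⟩
    (x + (y + (d ∸ x))) % d       ≡⟨ cong (_% d) (+-negate y x≤d) ⟩
    (y + d) % d                   ≡⟨ [m+n]%n≡m%n y d ⟩
    y % d                         ∎
    where open ≡-Reasoning

  +-cancelˡ-% : ∀ {x} y z → x ≤ d → (x + y) % d ≡ (x + z) % d → y % d ≡ z % d
  +-cancelˡ-% {x} y z x≤d e = begin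
    y % d                         ≡⟨ sym (subtract-add y x≤d) ⟩
    ((x + y) % d + (d ∸ x)) % d   ≡⟨ cong (λ t → (t + (d ∸ x)) % d) e ⟩
    ((x + z) % d + (d ∸ x)) % d   ≡⟨ subtract-add z x≤d ⟩
    z % d                         ∎
    where open ≡-Reasoning

-- Halving modulo the odd number q = 2a + 1: half j = j(a + 1) represents j/2.

module OddModulus (a : ℕ) where

  q : ℕ
  q = suc (a + a)

  open Modular q public

  twice : ℕ → ℕ
  twice x = (x + x) % q

  half : ℕ → ℕ
  half j = j * suc a

  half-twice : ∀ x → half (twice x) % q ≡ x % q
  half-twice x = begin
    ((x + x) % q * suc a) % q   ≡⟨ %-absorb-*ˡ (x + x) (suc a) ⟩
    ((x + x) * suc a) % q       ≡⟨ cong (_% q) (identity x a) ⟩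
    (x + x * q) % q             ≡⟨ [m+kn]%n≡m%n x x q ⟩
    x % q                       ∎
    where
    open ≡-Reasoning
    identity : ∀ x a → (x + x) * suc a ≡ x + x * suc (a + a)
    identity = solve-∀

  twice-half : ∀ j → twice (half j % q) ≡ j % q
  twice-half j = begin
    (half j % q + half j % q) % q   ≡⟨ %-absorbˡ (half j) (half j % q) ⟩
    (half j + half j % q) % q       ≡⟨ %-absorbʳ (half j) (half j) ⟩
    (half j + half j) % q           ≡⟨ cong (_% q) (identity j a) ⟩
    (j + j * q) % q                 ≡⟨ [m+kn]%n≡m%n j j q ⟩
    j % q                           ∎
    where
    open ≡-Reasoning
    identity : ∀ j a → j * suc a + j * suc a ≡ j + j * suc (a + a)
    identity = solve-∀

-- The 1-factorisation GK of the complete graph on ∞ and Z_q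

module Factorisation (a : ℕ) where

  open OddModulus a public

  Vertex : Set
  Vertex = Fin (suc q)

  ∞ : Vertex
  ∞ = zero

  residue : ℕ → Fin q
  residue m = fromℕ< (m%n<n m q)

  toℕ-residue : ∀ m → toℕ (residue m) ≡ m % q
  toℕ-residue m = toℕ-fromℕ< (m%n<n m q)

  cancel : ∀ (x y z : Fin q) → (toℕ x + toℕ y) % q ≡ (toℕ x + toℕ z) % q → y ≡ z
  cancel x y z e = toℕ-injective (begin
    toℕ y       ≡⟨ sym (m<n⇒m%n≡m (toℕ<n y)) ⟩
    toℕ y % q   ≡⟨ +-cancelˡ-% (toℕ y) (toℕ z) (<⇒≤ (toℕ<n x)) e ⟩
    toℕ z % q   ≡⟨ m<n⇒m%n≡m (toℕ<n z) ⟩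
    toℕ z       ∎)
    where open ≡-Reasoning

  colour : Vertex → Vertex → ℕ
  colour zero    zero    = 0
  colour zero    (suc y) = twice (toℕ y)
  colour (suc x) zero    = twice (toℕ x)
  colour (suc x) (suc y) = (toℕ x + toℕ y) % q

  colour-sym : ∀ v w → colour v w ≡ colour w v
  colour-sym zero    zero    = refl
  colour-sym zero    (suc y) = refl
  colour-sym (suc x) zero    = refl
  colour-sym (suc x) (suc y) = cong (_% q) (+-comm (toℕ x) (toℕ y))

  -- The mate of v along the colour-j edge: x ↦ j - x, except that the
  -- fixed point x = j/2 goes to ∞, and ∞ ↦ j/2.
  finiteMate : ∀ j (x : Fin q) → Dec (twice (toℕ x) ≡ j) → Vertex
  finiteMate j x (yes _) = ∞
  finiteMate j x (no _)  = suc (residue (j + (q ∸ toℕ x)))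

  mate : ℕ → Vertex → Vertex
  mate j zero    = suc (residue (half j))
  mate j (suc x) = finiteMate j x (twice (toℕ x) ≟ j)

  finiteMate-spec : ∀ {j} x → j < q → (d : Dec (twice (toℕ x) ≡ j)) →
    finiteMate j x d ≢ suc x × colour (suc x) (finiteMate j x d) ≡ j
  finiteMate-spec x j<q (yes twice≡j) = (λ ()) , twice≡j
  finiteMate-spec {j} x j<q (no twice≢j) = differs , hasColour
    where
    hasColour : (toℕ x + toℕ (residue (j + (q ∸ toℕ x)))) % q ≡ j
    hasColour = begin
      (toℕ x + toℕ (residue (j + (q ∸ toℕ x)))) % q   ≡⟨ cong (λ t → (toℕ x + t) % q) (toℕ-residue (j + (q ∸ toℕ x))) ⟩
      (toℕ x + (j + (q ∸ toℕ x)) % q) % q             ≡⟨ add-subtract j (<⇒≤ (toℕ<n x)) ⟩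
      j % q                                           ≡⟨ m<n⇒m%n≡m j<q ⟩
      j                                               ∎
      where open ≡-Reasoning
    differs : suc (residue (j + (q ∸ toℕ x))) ≢ suc x
    differs e = twice≢j (subst (λ y → (toℕ x + toℕ y) % q ≡ j) (suc-injective e) hasColour)

  mate-spec : ∀ {j} v → j < q → mate j v ≢ v × colour v (mate j v) ≡ j
  mate-spec {j} zero j<q = (λ ()) , (begin
    twice (toℕ (residue (half j)))   ≡⟨ cong twice (toℕ-residue (half j)) ⟩
    twice (half j % q)               ≡⟨ twice-half j ⟩
    j % q                            ≡⟨ m<n⇒m%n≡m j<q ⟩
    j                                ∎)
    where open ≡-Reasoning
  mate-spec (suc x) j<q = finiteMate-spec x j<q _

  finiteMate-unique : ∀ {j} x y → suc x ≢ suc y → (toℕ x + toℕ y) % q ≡ j →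
    (d : Dec (twice (toℕ x) ≡ j)) → finiteMate j x d ≡ suc y
  finiteMate-unique x y x≢y e (yes twice≡j) = ⊥-elim (x≢y (cong suc (cancel x x y (trans twice≡j (sym e)))))
  finiteMate-unique x y x≢y e (no twice≢j) =
    cong suc (cancel x _ y (trans (proj₂ (finiteMate-spec x j<q (no twice≢j))) (sym e)))
    where
    j<q = subst (_< q) e (m%n<n (toℕ x + toℕ y) q)

  mate-unique : ∀ {j} v w → v ≢ w → colour v w ≡ j → mate j v ≡ w
  mate-unique zero    zero    v≢w e = ⊥-elim (v≢w refl)
  mate-unique {j} zero (suc y) v≢w e = cong suc (toℕ-injective (begin
    toℕ (residue (half j))       ≡⟨ toℕ-residue (half j) ⟩
    half j % q                   ≡⟨ cong (λ t → half t % q) (sym e) ⟩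
    half (twice (toℕ y)) % q     ≡⟨ half-twice (toℕ y) ⟩
    toℕ y % q                    ≡⟨ m<n⇒m%n≡m (toℕ<n y) ⟩
    toℕ y                        ∎))
    where open ≡-Reasoning
  mate-unique {j} (suc x) zero v≢w e with twice (toℕ x) ≟ j
  ... | yes _      = refl
  ... | no twice≢j = ⊥-elim (twice≢j e)
  mate-unique (suc x) (suc y) v≢w e = finiteMate-unique x y v≢w e _

  mate-involutive : ∀ {j} v → j < q → mate j (mate j v) ≡ v
  mate-involutive v j<q =
    mate-unique (mate _ v) v (proj₁ (mate-spec v j<q))
      (trans (colour-sym (mate _ v) v) (proj₂ (mate-spec v j<q)))

witness : ∀ {P : Set} (p? : Dec P) → does p? ≡ true → P
witness (yes p) _ = p
witness (no _)  ()

module ColourClasses (a k : ℕ) (k<q : k < suc (a + a)) where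

  open Factorisation a public

  Adjacent : Vertex → Vertex → Set
  Adjacent v w = v ≢ w × 1 ≤ colour v w × colour v w ≤ k

  adjacent? : ∀ v w → Dec (Adjacent v w)
  adjacent? v w = ¬? (v Fin.≟ w) ×-dec 1 ≤? colour v w ×-dec colour v w ≤? k

  adjacent-sym : ∀ v w → Adjacent v w → Adjacent w v
  adjacent-sym v w (v≢w , lower , upper) =
    v≢w ∘ sym , subst (1 ≤_) (colour-sym v w) lower , subst (_≤ k) (colour-sym v w) upper

  G : Graph (suc q)
  G = record
    { adj    = λ v w → does (adjacent? v w)
    ; sym    = λ v w → does-⇔ (mk⇔ (adjacent-sym v w) (adjacent-sym w v)) (adjacent? v w) (adjacent? w v)
    ; irrefl = λ v → dec-false (adjacent? v v) (λ adj → proj₁ adj refl) }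

  colourOf : Fin k → ℕ
  colourOf i = suc (toℕ i)

  colourOf<q : ∀ i → colourOf i < q
  colourOf<q i = <-≤-trans (s≤s (toℕ<n i)) k<q

  colourOf-mate : ∀ i v → colour v (mate (colourOf i) v) ≡ colourOf i
  colourOf-mate i v = proj₂ (mate-spec v (colourOf<q i))

  factor : Fin k → PerfectMatching G
  factor i = record
    { partner = mate (colourOf i)
    ; invol   = λ v → mate-involutive v (colourOf<q i)
    ; isEdge  = λ v → dec-true (adjacent? v _)
        ( proj₁ (mate-spec v (colourOf<q i)) ∘ sym
        , subst (1 ≤_) (sym (colourOf-mate i v)) (s≤s z≤n)
        , subst (_≤ k) (sym (colourOf-mate i v)) (toℕ<n i)) }

  covers : ∀ v w → adj G v w ≡ true → Σ (Fin k) λ i → partner (factor i) v ≡ w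
  covers v w t with witness (adjacent? v w) t
  ... | v≢w , lower , upper = byColour (colour v w) refl lower upper
    where
    byColour : ∀ c → colour v w ≡ c → 1 ≤ c → c ≤ k → Σ (Fin k) λ i → mate (colourOf i) v ≡ w
    byColour (suc c) e _ c<k =
      fromℕ< c<k , mate-unique v w v≢w (trans e (cong suc (sym (toℕ-fromℕ< c<k))))

  disjoint : ∀ i j v → partner (factor i) v ≡ partner (factor j) v → i ≡ j
  disjoint i j v e = toℕ-injective (ℕ.suc-injective (begin
    colourOf i                           ≡⟨ sym (colourOf-mate i v) ⟩
    colour v (mate (colourOf i) v)       ≡⟨ cong (colour v) e ⟩
    colour v (mate (colourOf j) v)       ≡⟨ colourOf-mate j v ⟩
    colourOf j                           ∎))
    where open ≡-Reasoning

  factorable : OneFactorable G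
  factorable = k , factor , covers , disjoint

  -- The neighbours of v are its k partners, one in each factor.
  regular : Regular k G
  regular v = countTrue-bijection (adj G v) (λ i → mate (colourOf i) v)
    (λ e → disjoint _ _ v e) (λ i → isEdge (factor i) v) (covers v)

  point : ∀ m → m < q → Vertex
  point m m<q = suc (fromℕ< m<q)

  colour-point : ∀ {m m′} (p : m < q) (p′ : m′ < q) → colour (point m p) (point m′ p′) ≡ (m + m′) % q
  colour-point p p′ = cong₂ (λ s t → (s + t) % q) (toℕ-fromℕ< p) (toℕ-fromℕ< p′)

  point-injective : ∀ {m m′} (p : m < q) (p′ : m′ < q) → point m p ≡ point m′ p′ → m ≡ m′
  point-injective p p′ e =
    trans (sym (toℕ-fromℕ< p)) (trans (cong toℕ (suc-injective e)) (toℕ-fromℕ< p′))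

  u : Vertex
  u = point 0 (s≤s z≤n)

  adjacent-u : ∀ {m} (p : m < q) → 1 ≤ m → m ≤ k → adj G u (point m p) ≡ true
  adjacent-u {m} p 1≤m m≤k = dec-true (adjacent? u (point m p))
    (u≢m , subst (1 ≤_) (sym colour≡m) 1≤m , subst (_≤ k) (sym colour≡m) m≤k)
    where
    colour≡m : colour u (point m p) ≡ m
    colour≡m = trans (colour-point (s≤s z≤n) p) (m<n⇒m%n≡m p)
    u≢m : u ≢ point m p
    u≢m e = <-irrefl (point-injective (s≤s z≤n) p e) 1≤m

  -- Points summing to k + 1 are not adjacent: k + 1 ≡ k + 1 or 0 is not a colour of G.
  non-adjacent : ∀ {m m′} (p : m < q) (p′ : m′ < q) → m + m′ ≡ suc k → adj G (point m p) (point m′ p′) ≡ false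
  non-adjacent p p′ sum = dec-false (adjacent? (point _ p) (point _ p′)) λ (_ , lower , upper) →
    notAColour (subst (λ c → 1 ≤ c × c ≤ k) (trans (colour-point p p′) (cong (_% q) sum)) (lower , upper))
    where
    notAColour : ¬ (1 ≤ suc k % q × suc k % q ≤ k)
    notAColour (lower , upper) with m≤n⇒m<n∨m≡n k<q
    ... | inj₁ k+1<q = <-irrefl refl (subst (_≤ k) (m<n⇒m%n≡m k+1<q) upper)
    ... | inj₂ k+1≡q = <-irrefl refl (subst (1 ≤_) (trans (cong (_% q) k+1≡q) (n%n≡0 q)) lower)

  i<k : ∀ (i : Fin (k / 2)) → toℕ i < k
  i<k i = <-≤-trans (toℕ<n i) (m/n≤m k 2)

  xs<q : ∀ (i : Fin (k / 2)) → suc (toℕ i) < q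
  xs<q i = ≤-<-trans (i<k i) k<q

  ys<q : ∀ (i : Fin (k / 2)) → k ∸ toℕ i < q
  ys<q i = ≤-<-trans (m∸n≤m k (toℕ i)) k<q

  xs : Fin (k / 2) → Vertex
  xs i = point (suc (toℕ i)) (xs<q i)

  ys : Fin (k / 2) → Vertex
  ys i = point (k ∸ toℕ i) (ys<q i)

  xs-adjacent : ∀ i → adj G u (xs i) ≡ true
  xs-adjacent i = adjacent-u (xs<q i) (s≤s z≤n) (i<k i)

  ys-adjacent : ∀ i → adj G u (ys i) ≡ true
  ys-adjacent i = adjacent-u (ys<q i) (m<n⇒0<n∸m (i<k i)) (m∸n≤m k (toℕ i))

  xs-ys-non-adjacent : ∀ i → adj G (xs i) (ys i) ≡ false
  xs-ys-non-adjacent i = non-adjacent (xs<q i) (ys<q i) (cong suc (m+[n∸m]≡n (<⇒≤ (i<k i))))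

  xs-injective : ∀ i j → xs i ≡ xs j → i ≡ j
  xs-injective i j e = toℕ-injective (ℕ.suc-injective (point-injective (xs<q i) (xs<q j) e))

  ys-injective : ∀ i j → ys i ≡ ys j → i ≡ j
  ys-injective i j e = toℕ-injective (∸-cancelˡ-≡ (<⇒≤ (i<k i)) (<⇒≤ (i<k j)) (point-injective (ys<q i) (ys<q j) e))

  -- i + 1 = k - j would give i + j + 1 = k, but i + j + 2 ≤ 2⌊k/2⌋ ≤ k.
  xs≢ys : ∀ i j → xs i ≢ ys j
  xs≢ys i j e = <-irrefl sum≡k (<-≤-trans (+-mono-≤-< (toℕ<n i) (toℕ<n j)) twoHalves≤k)
    where
    sum≡k : suc (toℕ i) + toℕ j ≡ k
    sum≡k = trans (cong (_+ toℕ j) (point-injective (xs<q i) (ys<q j) e)) (m∸n+n≡m (<⇒≤ (i<k j)))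
    twoHalves≤k : k / 2 + k / 2 ≤ k
    twoHalves≤k = subst (_≤ k) (trans (*-comm (k / 2) 2) (cong (k / 2 +_) (+-identityʳ (k / 2)))) (m/n*n≤m k 2)

NeighbourhoodPairs : ∀ {n} → ℕ → Graph n → Set
NeighbourhoodPairs {n} k G =
  Σ (Fin n) λ u → Σ (Fin (k / 2) → Fin n) λ x → Σ (Fin (k / 2) → Fin n) λ y →
    (∀ i → adj G u (x i) ≡ true) × (∀ i → adj G u (y i) ≡ true) ×
    (∀ i → adj G (x i) (y i) ≡ false) ×
    (∀ i j → x i ≡ x j → i ≡ j) × (∀ i j → y i ≡ y j → i ≡ j) ×
    (∀ i j → x i ≢ y j)

Conclusion : ℕ → ℕ → Set
Conclusion n k = Σ (Graph n) λ G → Regular k G × OneFactorable G × NeighbourhoodPairs k G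

construction : ∀ a k → k ≤ a + a → Conclusion (suc (suc (a + a))) k
construction a k k≤2a = G , regular , factorable ,
  u , xs , ys , xs-adjacent , ys-adjacent , xs-ys-non-adjacent , xs-injective , ys-injective , xs≢ys
  where open ColourClasses a k (s≤s k≤2a)

-- Even orders n = 2(a + 1) are q + 1 for the odd q = 2a + 1.
double-suc : ∀ a → suc (suc (a + a)) ≡ 2 * suc a
double-suc = solve-∀

lemma2p6 : (n k : ℕ) → (Σ ℕ λ m → n ≡ 2 * m) → 1 ≤ k → k ≤ n ∸ 2 →
    Σ (Graph n) λ G → Regular k G × OneFactorable G ×
      (Σ (Fin n) λ u → Σ (Fin (k / 2) → Fin n) λ x → Σ (Fin (k / 2) → Fin n) λ y →
        (∀ i → adj G u (x i) ≡ true) × (∀ i → adj G u (y i) ≡ true) ×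
        (∀ i → adj G (x i) (y i) ≡ false) ×
        (∀ i j → x i ≡ x j → i ≡ j) × (∀ i j → y i ≡ y j → i ≡ j) ×
        (∀ i j → x i ≢ y j))
-- For n = 0 no k with 1 ≤ k ≤ n - 2 exists; otherwise apply the construction.
lemma2p6 .(2 * zero)  (suc k) (zero , refl)  _ ()
lemma2p6 .(2 * suc a) k       (suc a , refl) _ k≤n-2 =
  subst (λ n → Conclusion n k) (double-suc a) (construction a k k≤2a)
  where
  k≤2a : k ≤ a + a
  k≤2a = subst (λ n → k ≤ n ∸ 2) (sym (double-suc a)) k≤n-2
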